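{- Let $a\ge 2$, $b,c\in\mathbb{N}$, let $Q$ be a feasible strategy for $(a,b,c)$-Mastermind, and let $i,j\in[a]$ be distinct. Suppose that for all $y\in[b]$ and $z\in[c]$ there exists a question $(q_1,q_2,q_3)\in Q$ with $q_1\in\{i,j\}$, $q_2\neq y$ and $q_3\neq z$. Then the projection strategy $Q_1(i,j)$ is a feasible strategy for $(a-1,b,c)$-Mastermind. Analogously, for $b\ge2$ and distinct $i,j\in[b]$: if for all $x\in[a]$, $z\in[c]$ there is $(q_1,q_2,q_3)\in Q$ with $q_2\in\{i,j\}$, $q_1\neq x$, $q_3\neq z$, then $Q_2(i,j)$ is feasible for $(a,b-1,c)$-Mastermind; and for $c\ge 2$ and distinct $i,j\in[c]$: if for all $x\in[a]$, $y\in[b]$ there is $(q_1,q_2,q_3)\in Q$ with $q_3\in\{i,j\}$, $q_1\neq x$, $q_2\neq y$, then $Q_3(i,j)$ is feasible for $(a,b,c-1)$-Mastermind.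
   Context: $[n]=\{1,\dots,n\}$. In $(a,b,c)$-Mastermind, secrets and questions are triples in $[a]\times[b]\times[c]$ (the three coordinates are called pegs, entries are called colors). For a secret $s$ and question $q$, $g(s,q)$ is the number of indices $k\in[3]$ with $s_k=q_k$. A strategy is a set $Q$ of questions; it is feasible if for all distinct secrets $s,s'$ there is $q\in Q$ with $g(s,q)\neq g(s',q)$. For a strategy $Q$ for $(a,b,c)$-Mastermind with $a\ge2$ and distinct $i,j\in[a]$, the projection strategy $Q_1(i,j)$ for $(a-1,b,c)$-Mastermind is obtained from $Q$ by replacing, in every question, a first coordinate equal to $j$ by $i$, and then decreasing by $1$ every first coordinate that is greater than $j$. $Q_2(i,j)$ and $Q_3(i,j)$ are defined analogously on the second and third coordinate. -}

module Defs where

open import Data.Nat using (ℕ; suc)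
open import Data.Fin using (Fin; punchOut)
open import Data.Fin.Properties using (_≟_)
open import Data.Product using (_×_; _,_; ∃)
open import Data.List using (List; map)
open import Data.List.Membership.Propositional using (_∈_)
open import Relation.Binary.PropositionalEquality using (_≡_; _≢_; sym)
open import Relation.Nullary using (¬_; yes; no)

-- Colors [a] are represented by Fin a (color k ∈ [a] ↔ Fin element k-1).
Question : ℕ → ℕ → ℕ → Set
Question a b c = Fin a × Fin b × Fin c

Secret : ℕ → ℕ → ℕ → Set
Secret = Question

Strategy : ℕ → ℕ → ℕ → Set
Strategy a b c = List (Question a b c)

δ : ∀ {n} → Fin n → Fin n → ℕ
δ x y with x ≟ y
... | yes _ = 1
... | no  _ = 0

g : ∀ {a b c} → Secret a b c → Question a b c → ℕ
g (s₁ , s₂ , s₃) (q₁ , q₂ , q₃) = δ s₁ q₁ Data.Nat.+ δ s₂ q₂ Data.Nat.+ δ s₃ q₃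

Feasible : ∀ {a b c} → Strategy a b c → Set
Feasible {a} {b} {c} Q =
  ∀ (s s' : Secret a b c) → s ≢ s' → ∃ λ q → q ∈ Q × g s q ≢ g s' q

-- Collapse map Fin (suc n) → Fin n for distinct i, j:
-- replace j by i, then decrease by one every color greater than j.
-- (punchOut {i = j} {j = x} _ removes j from the range: x ↦ x if x < j, x - 1 if x > j.)
collapse : ∀ {n} (i j : Fin (suc n)) → i ≢ j → Fin (suc n) → Fin n
collapse i j i≢j x with x ≟ j
... | yes _   = punchOut {i = j} {j = i} (λ e → i≢j (sym e))
... | no x≢j  = punchOut {i = j} {j = x} (λ e → x≢j (sym e))

proj₁Strat : ∀ {n b c} (i j : Fin (suc n)) → i ≢ j → Strategy (suc n) b c → Strategy n b c
proj₁Strat i j i≢j = map (λ { (x , y , z) → (collapse i j i≢j x , y , z) })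

proj₂Strat : ∀ {a n c} (i j : Fin (suc n)) → i ≢ j → Strategy a (suc n) c → Strategy a n c
proj₂Strat i j i≢j = map (λ { (x , y , z) → (x , collapse i j i≢j y , z) })

proj₃Strat : ∀ {a b n} (i j : Fin (suc n)) → i ≢ j → Strategy a b (suc n) → Strategy a b n
proj₃Strat i j i≢j = map (λ { (x , y , z) → (x , y , collapse i j i≢j z) })

{-# OPTIONS --safe #-}
module Submission where

-- Let m be the colour that i and j merge into. A secret s of the smaller game lifts to s↑ by
-- punchIn j on its first peg, and g s q↓ = g s↑ q + [s₁ = m]·[q₁ = j] for the projection q↓ of q.
-- So if both or neither of two secrets have first colour m, the projection of a question
-- separating their lifts separates them. If only s has first colour m, covering the other
-- two colours of s′ yields q with q₁ ∈ {i, j}, so g s′ q↓ = 0 while g s q↓ ≥ 1.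
-- Pegs 2 and 3 reduce to peg 1 by swapping coordinates, which preserves g.

open import Defs
open import Data.Nat using (ℕ; suc; _+_; _*_)
open import Data.Nat.Properties using (+-comm; +-cancelʳ-≡; +-identityʳ; *-identityʳ; *-zeroʳ; 1+n≢0)
open import Data.Nat.Tactic.RingSolver using (solve-∀)
open import Data.Fin using (Fin; punchIn; punchOut)
open import Data.Fin.Properties using (_≟_; punchIn-injective; punchInᵢ≢i; punchIn-punchOut; punchOut-punchIn; punchOut-cong)
open import Data.Product using (_×_; _,_; ∃; proj₁; proj₂)
open import Data.Sum using (_⊎_; inj₁; inj₂; [_,_]′)
open import Data.List using ([]; _∷_; map)
open import Data.List.Membership.Propositional using (_∈_)
open import Data.List.Membership.Propositional.Properties using (∈-map⁺)
open import Function using (_∘_; _⇔_; mk⇔; Equivalence)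
open import Relation.Binary.PropositionalEquality
open import Relation.Nullary using (yes; no; contradiction)
open import Relation.Nullary.Decidable using (toSum)

δ-≡ : ∀ {m} {x y : Fin m} → x ≡ y → δ x y ≡ 1
δ-≡ {x = x} {y} x≡y with x ≟ y
... | yes _   = refl
... | no x≢y = contradiction x≡y x≢y

δ-≢ : ∀ {m} {x y : Fin m} → x ≢ y → δ x y ≡ 0
δ-≢ {x = x} {y} x≢y with x ≟ y
... | yes x≡y = contradiction x≡y x≢y
... | no _    = refl

δ-cong-⇔ : ∀ {m k} {x y : Fin m} {x′ y′ : Fin k} → (x ≡ y ⇔ x′ ≡ y′) → δ x y ≡ δ x′ y′
δ-cong-⇔ {x = x} {y} x≡y⇔x′≡y′ with x ≟ y
... | yes x≡y = sym (δ-≡ (Equivalence.to x≡y⇔x′≡y′ x≡y))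
... | no x≢y  = sym (δ-≢ (x≢y ∘ Equivalence.from x≡y⇔x′≡y′))

≡punchOut⇔punchIn≡ : ∀ {n} {i y : Fin (suc n)} {u : Fin n} (i≢y : i ≢ y) →
                     (u ≡ punchOut i≢y ⇔ punchIn i u ≡ y)
≡punchOut⇔punchIn≡ {i = i} i≢y = mk⇔
  (λ u≡ → trans (cong (punchIn i) u≡) (punchIn-punchOut i≢y))
  (λ ≡y → trans (sym (punchOut-punchIn i)) (punchOut-cong i ≡y))

g-hit₁ : ∀ {a b c} {x x′ : Fin a} {y y′ : Fin b} {z z′ : Fin c} →
         x ≡ x′ → g (x , y , z) (x′ , y′ , z′) ≢ 0
g-hit₁ x≡x′ rewrite δ-≡ x≡x′ = 1+n≢0

g-miss : ∀ {a b c} {x x′ : Fin a} {y y′ : Fin b} {z z′ : Fin c} →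
         x ≢ x′ → y ≢ y′ → z ≢ z′ → g (x , y , z) (x′ , y′ , z′) ≡ 0
g-miss x≢x′ y≢y′ z≢z′ rewrite δ-≢ x≢x′ | δ-≢ y≢y′ | δ-≢ z≢z′ = refl

Separates : ∀ {a b c} → Strategy a b c → Secret a b c → Secret a b c → Set
Separates Q s s′ = ∃ λ q → q ∈ Q × g s q ≢ g s′ q

Separates-sym : ∀ {a b c} {Q : Strategy a b c} {s s′} → Separates Q s s′ → Separates Q s′ s
Separates-sym (q , q∈Q , gs≢gs′) = q , q∈Q , ≢-sym gs≢gs′

Covers₁ : ∀ {a b c} → Strategy a b c → Fin a → Fin a → Set
Covers₁ {b = b} {c} Q i j = ∀ (y : Fin b) (z : Fin c) → ∃ λ q → q ∈ Q
  × ((proj₁ q ≡ i ⊎ proj₁ q ≡ j) × (proj₁ (proj₂ q) ≢ y) × (proj₂ (proj₂ q) ≢ z))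

Covers₂ : ∀ {a b c} → Strategy a b c → Fin b → Fin b → Set
Covers₂ {a} {c = c} Q i j = ∀ (x : Fin a) (z : Fin c) → ∃ λ q → q ∈ Q
  × ((proj₁ (proj₂ q) ≡ i ⊎ proj₁ (proj₂ q) ≡ j) × (proj₁ q ≢ x) × (proj₂ (proj₂ q) ≢ z))

Covers₃ : ∀ {a b c} → Strategy a b c → Fin c → Fin c → Set
Covers₃ {a} {b} Q i j = ∀ (x : Fin a) (y : Fin b) → ∃ λ q → q ∈ Q
  × ((proj₂ (proj₂ q) ≡ i ⊎ proj₂ (proj₂ q) ≡ j) × (proj₁ q ≢ x) × (proj₁ (proj₂ q) ≢ y))

module Collapse {n : ℕ} (i j : Fin (suc n)) (i≢j : i ≢ j) where

  merged : Fin n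
  merged = collapse i j i≢j i

  collapse-≢ : ∀ {x} (x≢j : x ≢ j) → collapse i j i≢j x ≡ punchOut (x≢j ∘ sym)
  collapse-≢ {x} x≢j with x ≟ j
  ... | yes x≡j = contradiction x≡j x≢j
  ... | no _    = punchOut-cong j refl

  collapse-j : collapse i j i≢j j ≡ merged
  collapse-j with j ≟ j
  ... | yes _   = sym (collapse-≢ i≢j)
  ... | no j≢j = contradiction refl j≢j

  collapse-merges : ∀ {x} → x ≡ i ⊎ x ≡ j → collapse i j i≢j x ≡ merged
  collapse-merges (inj₁ refl) = refl
  collapse-merges (inj₂ refl) = collapse-j

  δ-collapse-≡j : ∀ u {y} → y ≡ j → δ u (collapse i j i≢j y) ≡ δ (punchIn j u) y + δ u merged * δ y j
  δ-collapse-≡j u refl = begin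
    δ u (collapse i j i≢j j)                 ≡⟨ cong (δ u) collapse-j ⟩
    δ u merged                               ≡⟨ sym (*-identityʳ _) ⟩
    δ u merged * 1                           ≡⟨ cong₂ (λ d e → d + δ u merged * e)
                                                      (sym (δ-≢ (punchInᵢ≢i j u))) (sym (δ-≡ refl)) ⟩
    δ (punchIn j u) j + δ u merged * δ j j   ∎
    where open ≡-Reasoning

  δ-collapse-≢j : ∀ u {y} → y ≢ j → δ u (collapse i j i≢j y) ≡ δ (punchIn j u) y + δ u merged * δ y j
  δ-collapse-≢j u {y} y≢j = begin
    δ u (collapse i j i≢j y)                 ≡⟨ cong (δ u) (collapse-≢ y≢j) ⟩
    δ u (punchOut (y≢j ∘ sym))               ≡⟨ δ-cong-⇔ (≡punchOut⇔punchIn≡ (y≢j ∘ sym)) ⟩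
    δ (punchIn j u) y                        ≡⟨ sym (+-identityʳ _) ⟩
    δ (punchIn j u) y + 0                    ≡⟨ cong (δ (punchIn j u) y +_) (sym no-match) ⟩
    δ (punchIn j u) y + δ u merged * δ y j   ∎
    where
    open ≡-Reasoning
    no-match : δ u merged * δ y j ≡ 0
    no-match = trans (cong (δ u merged *_) (δ-≢ y≢j)) (*-zeroʳ (δ u merged))

  δ-collapse : ∀ u y → δ u (collapse i j i≢j y) ≡ δ (punchIn j u) y + δ u merged * δ y j
  δ-collapse u y = [ δ-collapse-≡j u , δ-collapse-≢j u ]′ (toSum (y ≟ j))

module FirstPeg {n b c : ℕ} (i j : Fin (suc n)) (i≢j : i ≢ j) where
  open Collapse i j i≢j

  lift₁ : Question n b c → Question (suc n) b c
  lift₁ (u , y , z) = punchIn j u , y , z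

  collapse₁ : Question (suc n) b c → Question n b c
  collapse₁ (x , y , z) = collapse i j i≢j x , y , z

  lift₁-injective : ∀ {s s′} → lift₁ s ≡ lift₁ s′ → s ≡ s′
  lift₁-injective {u , _} {u′ , _} e = cong₂ _,_ (punchIn-injective j u u′ (cong proj₁ e)) (cong proj₂ e)

  collapse₁-∈ : ∀ {Q q} → q ∈ Q → collapse₁ q ∈ proj₁Strat i j i≢j Q
  collapse₁-∈ {q = _ , _ , _} = ∈-map⁺ _

  g-collapse₁ : ∀ s q → g s (collapse₁ q) ≡ g (lift₁ s) q + δ (proj₁ s) merged * δ (proj₁ q) j
  g-collapse₁ (u , y , z) (x , y′ , z′) = begin
    δ u (collapse i j i≢j x) + δ y y′ + δ z z′   ≡⟨ cong (λ d → d + δ y y′ + δ z z′) (δ-collapse u x) ⟩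
    δ (punchIn j u) x + lost + δ y y′ + δ z z′   ≡⟨ move-last (δ (punchIn j u) x) lost (δ y y′) (δ z z′) ⟩
    δ (punchIn j u) x + δ y y′ + δ z z′ + lost   ∎
    where
    open ≡-Reasoning
    lost : ℕ
    lost = δ u merged * δ x j
    move-last : ∀ d e k l → d + e + k + l ≡ d + k + l + e
    move-last = solve-∀

  module _ {Q : Strategy (suc n) b c} (feasible : Feasible Q) (covers : Covers₁ Q i j) where

    separate-lifted : ∀ {s s′} → s ≢ s′ → δ (proj₁ s) merged ≡ δ (proj₁ s′) merged →
                      Separates (proj₁Strat i j i≢j Q) s s′
    separate-lifted {s} {s′} s≢s′ same with feasible (lift₁ s) (lift₁ s′) (s≢s′ ∘ lift₁-injective)
    ... | q , q∈Q , separated = collapse₁ q , collapse₁-∈ q∈Q , separated ∘ cancel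
      where
      cancel : g s (collapse₁ q) ≡ g s′ (collapse₁ q) → g (lift₁ s) q ≡ g (lift₁ s′) q
      cancel e = +-cancelʳ-≡ _ _ _ (begin
        g (lift₁ s) q + δ (proj₁ s) merged * δ (proj₁ q) j    ≡⟨ sym (g-collapse₁ s q) ⟩
        g s (collapse₁ q)                                      ≡⟨ e ⟩
        g s′ (collapse₁ q)                                     ≡⟨ g-collapse₁ s′ q ⟩
        g (lift₁ s′) q + δ (proj₁ s′) merged * δ (proj₁ q) j  ≡⟨ cong (λ d → g (lift₁ s′) q + d * δ (proj₁ q) j) (sym same) ⟩
        g (lift₁ s′) q + δ (proj₁ s) merged * δ (proj₁ q) j   ∎)
        where open ≡-Reasoning

    separate-merged : ∀ {s s′} → proj₁ s ≡ merged → proj₁ s′ ≢ merged →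
                      Separates (proj₁Strat i j i≢j Q) s s′
    separate-merged {u , y , z} {u′ , y′ , z′} u≡merged u′≢merged with covers y′ z′
    ... | (x , v , w) , q∈Q , x∈ij , v≢y′ , w≢z′ =
      collapse₁ (x , v , w) , collapse₁-∈ q∈Q ,
      λ e → g-hit₁ hit (trans e (g-miss miss (≢-sym v≢y′) (≢-sym w≢z′)))
      where
      hit : u ≡ collapse i j i≢j x
      hit = trans u≡merged (sym (collapse-merges x∈ij))
      miss : u′ ≢ collapse i j i≢j x
      miss u′≡ = u′≢merged (trans u′≡ (collapse-merges x∈ij))

    projection-feasible : Feasible (proj₁Strat i j i≢j Q)
    projection-feasible s s′ s≢s′ with proj₁ s ≟ merged | proj₁ s′ ≟ merged
    ... | yes e | yes e′ = separate-lifted s≢s′ (trans (δ-≡ e) (sym (δ-≡ e′)))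
    ... | no e  | no e′  = separate-lifted s≢s′ (trans (δ-≢ e) (sym (δ-≢ e′)))
    ... | yes e | no e′  = separate-merged e e′
    ... | no e  | yes e′ = Separates-sym {s = s′} {s} (separate-merged e′ e)

proj₁Strat-feasible : ∀ (n b c : ℕ) (Q : Strategy (suc n) b c) (i j : Fin (suc n)) (i≢j : i ≢ j) →
                      Feasible Q → Covers₁ Q i j → Feasible (proj₁Strat i j i≢j Q)
proj₁Strat-feasible n b c Q i j i≢j = FirstPeg.projection-feasible i j i≢j

feasible-map : ∀ {a b c a′ b′ c′} (ρ : Question a b c → Question a′ b′ c′) (ρ⁻¹ : Question a′ b′ c′ → Question a b c) →
               (∀ s → ρ (ρ⁻¹ s) ≡ s) → (∀ s q → g (ρ s) (ρ q) ≡ g s q) →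
               ∀ {Q} → Feasible Q → Feasible (map ρ Q)
feasible-map ρ ρ⁻¹ ρ∘ρ⁻¹ g-ρ feasible s s′ s≢s′
  with feasible (ρ⁻¹ s) (ρ⁻¹ s′) (λ e → s≢s′ (trans (sym (ρ∘ρ⁻¹ s)) (trans (cong ρ e) (ρ∘ρ⁻¹ s′))))
... | q , q∈Q , separated = ρ q , ∈-map⁺ ρ q∈Q , separated ∘ transport
  where
  transport : g s (ρ q) ≡ g s′ (ρ q) → g (ρ⁻¹ s) q ≡ g (ρ⁻¹ s′) q
  transport e = begin
    g (ρ⁻¹ s) q           ≡⟨ sym (g-ρ (ρ⁻¹ s) q) ⟩
    g (ρ (ρ⁻¹ s)) (ρ q)   ≡⟨ cong (λ t → g t (ρ q)) (ρ∘ρ⁻¹ s) ⟩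
    g s (ρ q)             ≡⟨ e ⟩
    g s′ (ρ q)            ≡⟨ cong (λ t → g t (ρ q)) (sym (ρ∘ρ⁻¹ s′)) ⟩
    g (ρ (ρ⁻¹ s′)) (ρ q)  ≡⟨ g-ρ (ρ⁻¹ s′) q ⟩
    g (ρ⁻¹ s′) q          ∎
    where open ≡-Reasoning

swap₁₂ : ∀ {a b c} → Question a b c → Question b a c
swap₁₂ (x , y , z) = y , x , z

swap₁₃ : ∀ {a b c} → Question a b c → Question c b a
swap₁₃ (x , y , z) = z , y , x

swap₁₂-involutive : ∀ {a b c} (s : Question a b c) → swap₁₂ (swap₁₂ s) ≡ s
swap₁₂-involutive (x , y , z) = refl

swap₁₃-involutive : ∀ {a b c} (s : Question a b c) → swap₁₃ (swap₁₃ s) ≡ s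
swap₁₃-involutive (x , y , z) = refl

g-swap₁₂ : ∀ {a b c} (s q : Question a b c) → g (swap₁₂ s) (swap₁₂ q) ≡ g s q
g-swap₁₂ (x , y , z) (x′ , y′ , z′) = cong (_+ δ z z′) (+-comm (δ y y′) (δ x x′))

g-swap₁₃ : ∀ {a b c} (s q : Question a b c) → g (swap₁₃ s) (swap₁₃ q) ≡ g s q
g-swap₁₃ (x , y , z) (x′ , y′ , z′) = reverse (δ z z′) (δ y y′) (δ x x′)
  where
  reverse : ∀ k l m → k + l + m ≡ m + l + k
  reverse = solve-∀

feasible-swap₁₂ : ∀ {a b c} {Q : Strategy a b c} → Feasible Q → Feasible (map swap₁₂ Q)
feasible-swap₁₂ = feasible-map swap₁₂ swap₁₂ swap₁₂-involutive g-swap₁₂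

feasible-swap₁₃ : ∀ {a b c} {Q : Strategy a b c} → Feasible Q → Feasible (map swap₁₃ Q)
feasible-swap₁₃ = feasible-map swap₁₃ swap₁₃ swap₁₃-involutive g-swap₁₃

covers-swap₁₂ : ∀ {a b c} {Q : Strategy a b c} {i j} → Covers₂ Q i j → Covers₁ (map swap₁₂ Q) i j
covers-swap₁₂ covers x z with covers x z
... | (q₁ , q₂ , q₃) , q∈Q , q₂∈ij , q₁≢x , q₃≢z = (q₂ , q₁ , q₃) , ∈-map⁺ swap₁₂ q∈Q , q₂∈ij , q₁≢x , q₃≢z

covers-swap₁₃ : ∀ {a b c} {Q : Strategy a b c} {i j} → Covers₃ Q i j → Covers₁ (map swap₁₃ Q) i j
covers-swap₁₃ covers y x with covers x y
... | (q₁ , q₂ , q₃) , q∈Q , q₃∈ij , q₁≢x , q₂≢y = (q₃ , q₂ , q₁) , ∈-map⁺ swap₁₃ q∈Q , q₃∈ij , q₂≢y , q₁≢x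

proj₂Strat-via-swap₁₂ : ∀ {a n c} (i j : Fin (suc n)) (i≢j : i ≢ j) (Q : Strategy a (suc n) c) →
                        map swap₁₂ (proj₁Strat i j i≢j (map swap₁₂ Q)) ≡ proj₂Strat i j i≢j Q
proj₂Strat-via-swap₁₂ i j i≢j []                = refl
proj₂Strat-via-swap₁₂ i j i≢j ((x , y , z) ∷ Q) = cong (_ ∷_) (proj₂Strat-via-swap₁₂ i j i≢j Q)

proj₃Strat-via-swap₁₃ : ∀ {a b n} (i j : Fin (suc n)) (i≢j : i ≢ j) (Q : Strategy a b (suc n)) →
                        map swap₁₃ (proj₁Strat i j i≢j (map swap₁₃ Q)) ≡ proj₃Strat i j i≢j Q
proj₃Strat-via-swap₁₃ i j i≢j []                = refl
proj₃Strat-via-swap₁₃ i j i≢j ((x , y , z) ∷ Q) = cong (_ ∷_) (proj₃Strat-via-swap₁₃ i j i≢j Q)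

proj₂Strat-feasible : ∀ (a n c : ℕ) (Q : Strategy a (suc n) c) (i j : Fin (suc n)) (i≢j : i ≢ j) →
                      Feasible Q → Covers₂ Q i j → Feasible (proj₂Strat i j i≢j Q)
proj₂Strat-feasible a n c Q i j i≢j feasible covers =
  subst Feasible (proj₂Strat-via-swap₁₂ i j i≢j Q)
    (feasible-swap₁₂ (proj₁Strat-feasible n a c (map swap₁₂ Q) i j i≢j (feasible-swap₁₂ feasible) (covers-swap₁₂ covers)))

proj₃Strat-feasible : ∀ (a b n : ℕ) (Q : Strategy a b (suc n)) (i j : Fin (suc n)) (i≢j : i ≢ j) →
                      Feasible Q → Covers₃ Q i j → Feasible (proj₃Strat i j i≢j Q)
proj₃Strat-feasible a b n Q i j i≢j feasible covers =
  subst Feasible (proj₃Strat-via-swap₁₃ i j i≢j Q)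
    (feasible-swap₁₃ (proj₁Strat-feasible n b a (map swap₁₃ Q) i j i≢j (feasible-swap₁₃ feasible) (covers-swap₁₃ covers)))

lemma3 : (∀ (n b c : ℕ) (Q : Strategy (suc n) b c) (i j : Fin (suc n)) (i≢j : i ≢ j)
      → Feasible Q
      → (∀ (y : Fin b) (z : Fin c) → ∃ λ q → q ∈ Q
           × ((Data.Product.proj₁ q ≡ i ⊎ Data.Product.proj₁ q ≡ j)
           × (Data.Product.proj₁ (Data.Product.proj₂ q) ≢ y)
           × (Data.Product.proj₂ (Data.Product.proj₂ q) ≢ z)))
      → Feasible (proj₁Strat i j i≢j Q))
    × (∀ (a n c : ℕ) (Q : Strategy a (suc n) c) (i j : Fin (suc n)) (i≢j : i ≢ j)
      → Feasible Q
      → (∀ (x : Fin a) (z : Fin c) → ∃ λ q → q ∈ Q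
           × ((Data.Product.proj₁ (Data.Product.proj₂ q) ≡ i ⊎ Data.Product.proj₁ (Data.Product.proj₂ q) ≡ j)
           × (Data.Product.proj₁ q ≢ x)
           × (Data.Product.proj₂ (Data.Product.proj₂ q) ≢ z)))
      → Feasible (proj₂Strat i j i≢j Q))
    × (∀ (a b n : ℕ) (Q : Strategy a b (suc n)) (i j : Fin (suc n)) (i≢j : i ≢ j)
      → Feasible Q
      → (∀ (x : Fin a) (y : Fin b) → ∃ λ q → q ∈ Q
           × ((Data.Product.proj₂ (Data.Product.proj₂ q) ≡ i ⊎ Data.Product.proj₂ (Data.Product.proj₂ q) ≡ j)
           × (Data.Product.proj₁ q ≢ x)
           × (Data.Product.proj₁ (Data.Product.proj₂ q) ≢ y)))
      → Feasible (proj₃Strat i j i≢j Q))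
lemma3 = proj₁Strat-feasible , proj₂Strat-feasible , proj₃Strat-feasible
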